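{- Let $P_n$ be the path of order $n\geq 3$ and let $H$ be a connected graph of order $m\geq 1$. Then $D'(P_n[H])=2$.
   Context: All graphs are finite and simple. For a graph $X$, an edge labeling $\psi:E(X)\to\{1,\dots,d\}$ is distinguishing if the only automorphism of $X$ preserving all edge labels is the identity; the distinguishing index $D'(X)$ is the least $d$ such that $X$ has a distinguishing edge labeling with $d$ labels. The lexicographic product $G[H]$ has vertex set $V(G)\times V(H)$, with $(a,x)$ adjacent to $(b,y)$ iff $ab\in E(G)$, or $a=b$ and $xy\in E(H)$. -}

module Defs where

open import Level using (0ℓ)
open import Data.Nat using (ℕ; zero; suc; _<_; _≥_)
open import Data.Fin using (Fin; toℕ)
open import Data.Product using (Σ; _×_; _,_)
open import Data.Sum using (_⊎_)
open import Data.Empty using (⊥)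
open import Relation.Nullary using (¬_)
open import Relation.Binary.PropositionalEquality using (_≡_)
open import Function.Bundles using (_↔_; Inverse)

record Graph (V : Set) : Set₁ where
  field
    Adj    : V → V → Set
    sym    : ∀ {u v} → Adj u v → Adj v u
    irrefl : ∀ {v} → ¬ Adj v v
    -- simple graph: adjacency is a proposition (at most one edge between u and v)
    prop   : ∀ {u v} (p q : Adj u v) → p ≡ q
open Graph public using (Adj)

PathAdj : ∀ {n} → Fin n → Fin n → Set
PathAdj i j = (suc (toℕ i) ≡ toℕ j) ⊎ (suc (toℕ j) ≡ toℕ i)

PathGraph : (n : ℕ) → Graph (Fin n)
PathGraph n = record { Adj = PathAdj ; sym = s ; irrefl = ir ; prop = pr }
  where
  open import Data.Sum using (inj₁; inj₂)
  open import Data.Nat.Properties using (1+n≢n; ≡-irrelevant; suc-injective)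
  open import Relation.Binary.PropositionalEquality using (sym; cong; trans; refl)
  open import Data.Empty using (⊥-elim)
  s : ∀ {u v} → PathAdj u v → PathAdj v u
  s (inj₁ p) = inj₂ p
  s (inj₂ p) = inj₁ p
  ir : ∀ {v} → ¬ PathAdj v v
  ir (inj₁ p) = 1+n≢n p
  ir (inj₂ p) = 1+n≢n p
  no2 : ∀ {a b : ℕ} → suc a ≡ b → suc b ≡ a → ⊥
  no2 {zero} _ ()
  no2 {suc a} {suc b} p q = no2 (suc-injective p) (suc-injective q)
  pr : ∀ {u v} (p q : PathAdj u v) → p ≡ q
  pr (inj₁ p) (inj₁ q) = cong inj₁ (≡-irrelevant p q)
  pr (inj₂ p) (inj₂ q) = cong inj₂ (≡-irrelevant p q)
  pr (inj₁ p) (inj₂ q) = ⊥-elim (no2 p q)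
  pr (inj₂ p) (inj₁ q) = ⊥-elim (no2 q p)

LexAdj : ∀ {A B} → Graph A → Graph B → A × B → A × B → Set
LexAdj G H (a , x) (b , y) = Adj G a b ⊎ ((a ≡ b) × Adj H x y)

Lex : ∀ {k B} → Graph (Fin k) → Graph B → Graph (Fin k × B)
Lex {k} {B} G H = record { Adj = LexAdj G H ; sym = s ; irrefl = ir ; prop = pr }
  where
  open import Data.Sum using (inj₁; inj₂)
  open import Relation.Binary.PropositionalEquality as Eq using ()
  import Data.Fin.Properties as FinP
  import Axiom.UniquenessOfIdentityProofs as UIP
  open import Data.Empty using (⊥-elim)
  s : ∀ {u v} → LexAdj G H u v → LexAdj G H v u
  s (inj₁ p) = inj₁ (Graph.sym G p)
  s (inj₂ (e , p)) = inj₂ (Eq.sym e , Graph.sym H p)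
  ir : ∀ {v} → ¬ LexAdj G H v v
  ir (inj₁ p) = Graph.irrefl G p
  ir (inj₂ (_ , p)) = Graph.irrefl H p
  pr : ∀ {u v} (p q : LexAdj G H u v) → p ≡ q
  pr (inj₁ p) (inj₁ q) = Eq.cong inj₁ (Graph.prop G p q)
  pr (inj₂ (e , p)) (inj₂ (f , q)) =
    Eq.cong inj₂ (Eq.cong₂ _,_ (UIP.Decidable⇒UIP.≡-irrelevant FinP._≟_ e f) (Graph.prop H p q))
  pr (inj₁ p) (inj₂ (Eq.refl , _)) = ⊥-elim (Graph.irrefl G p)
  pr (inj₂ (Eq.refl , _)) (inj₁ q) = ⊥-elim (Graph.irrefl G q)

data Reach {V : Set} (G : Graph V) : V → V → Set where
  here : ∀ {v} → Reach G v v
  step : ∀ {u v w} → Adj G u v → Reach G v w → Reach G u w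

Connected : ∀ {V} → Graph V → Set
Connected G = ∀ u v → Reach G u v

record Automorphism {V : Set} (G : Graph V) : Set where
  field
    perm     : V ↔ V
  open Inverse perm public using (to)
  field
    preserve : ∀ u v → (Adj G u v → Adj G (to u) (to v)) × (Adj G (to u) (to v) → Adj G u v)

record EdgeLabeling {V : Set} (G : Graph V) (d : ℕ) : Set where
  field
    label     : ∀ u v → Adj G u v → Fin d
    label-sym : ∀ u v (e : Adj G u v) → label v u (Graph.sym G e) ≡ label u v e

Distinguishing : ∀ {V} {G : Graph V} {d} → EdgeLabeling G d → Set
Distinguishing {V} {G} ψ =
  (σ : Automorphism G) →
  (∀ u v (e : Adj G u v) →
     EdgeLabeling.label ψ (Automorphism.to σ u) (Automorphism.to σ v)
       (Data.Product.proj₁ (Automorphism.preserve σ u v) e)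
     ≡ EdgeLabeling.label ψ u v e) →
  ∀ v → Automorphism.to σ v ≡ v
  where import Data.Product

HasDistinguishingLabeling : ∀ {V} → Graph V → ℕ → Set
HasDistinguishingLabeling G d = Σ (EdgeLabeling G d) Distinguishing

DistinguishingIndex≡ : ∀ {V} → Graph V → ℕ → Set
DistinguishingIndex≡ G d =
  HasDistinguishingLabeling G d × (∀ k → k < d → ¬ HasDistinguishingLabeling G k)

-- Colour red (label 1) the edges (0,x)(1,x) and (0,x)(1,x+1) between the two bottom layers,
-- which form a zigzag path (1,0),(0,0),(1,1),(0,1),…, and the row edges (i,y)(i+1,y) for
-- i, y ≥ 1; all other edges are blue. The red-isolated vertices are exactly the (i,0) with
-- i ≥ 2. A label-preserving automorphism σ preserves the red graph, hence every property
-- defined from the red graph and the adjacency of G. The vertex (0,0) is the only vertex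
-- that is adjacent to no red-isolated vertex and has a red neighbour of red degree one, so
-- σ fixes it. Along the zigzag, each next vertex is the only unfixed red neighbour of the
-- previous one with a suitable invariant property, so σ fixes the two bottom layers; the
-- rows are then fixed layer by layer, and the vertex (i+1,0) is the only unfixed neighbour
-- of (i,0). Conversely, with one label the reflection of the path is label-preserving.
module Submission where

open import Defs
open import Data.Nat using (ℕ; zero; suc; _≥_; _≤_; _<_; _∸_; z≤n; s≤s)
open import Data.Nat.Properties
  using (+-∸-assoc; ≤-refl; ≤-trans; ≤-reflexive; ≤-pred; <-trans; n<1+n; n≤1+n;
         n≤0⇒n≡0; 1+n≢n; m≤n⇒m<n∨m≡n; suc-injective; _≟_; _<?_; ≮⇒≥; ≤∧≢⇒<)
open import Data.Fin using (Fin; zero; suc; toℕ; fromℕ<; opposite)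
open import Data.Fin.Properties
  using (toℕ-injective; toℕ-fromℕ<; toℕ<n; opposite-prop; opposite-involutive)
open import Data.Product using (Σ; _×_; _,_; proj₁; proj₂)
open import Data.Sum using (_⊎_; inj₁; inj₂; [_,_]; swap)
import Data.Sum as Sum
open import Data.Empty using (⊥-elim)
open import Data.Unit using (⊤; tt)
open import Relation.Nullary using (¬_; Dec; yes; no)
open import Relation.Binary.PropositionalEquality
  using (_≡_; _≢_; refl; sym; trans; cong; cong₂; subst; subst₂; module ≡-Reasoning)
open import Function.Bundles using (_↔_; Inverse; mk↔ₛ′)

module _ {V : Set} (R : V → V → Set) where

  Isolated : V → Set
  Isolated z = ∀ y → ¬ R z y

  AtMostOneNeighbour : V → Set
  AtMostOneNeighbour w = ∀ p q → R w p → R w q → p ≡ q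

  TwoNeighbours : V → Set
  TwoNeighbours u = Σ V λ p → Σ V λ q → R u p × R u q × p ≢ q

AwayFromIsolated : {V : Set} → (V → V → Set) → (V → V → Set) → V → Set
AwayFromIsolated S R u = ∀ z → Isolated R z → ¬ S u z

module Symmetry {V : Set} (π : V ↔ V) where
  open Inverse π public using (to; from)
  open Inverse π using (strictlyInverseˡ; strictlyInverseʳ)

  Fixed : V → Set
  Fixed v = to v ≡ v

  Invariant : (V → Set) → Set
  Invariant Q = ∀ {v} → Q v → Q (to v)

  record Preserves (R : V → V → Set) : Set where
    field
      forward  : ∀ {u v} → R u v → R (to u) (to v)
      backward : ∀ {u v} → R (to u) (to v) → R u v

  to-injective : ∀ {a b} → to a ≡ to b → a ≡ b
  to-injective {a} {b} p = begin
    a           ≡⟨ sym (strictlyInverseʳ a) ⟩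
    from (to a) ≡⟨ cong from p ⟩
    from (to b) ≡⟨ strictlyInverseʳ b ⟩
    b           ∎
    where open ≡-Reasoning

  module _ {R : V → V → Set} (preserves : Preserves R) where
    open Preserves preserves

    backward-from : ∀ {u v} → R (to u) v → R u (from v)
    backward-from {u} {v} r = backward (subst (R (to u)) (sym (strictlyInverseˡ v)) r)

    fixed-by-unique-candidate : ∀ {Q} → Invariant Q → ∀ {u v} → Fixed u → R u v → Q v →
      (∀ w → R u w → Q w → w ≡ v ⊎ Fixed w) → Fixed v
    fixed-by-unique-candidate invariant {u} {v} fixed r q candidates
      with candidates (to v) (subst (λ z → R z (to v)) fixed (forward r)) (invariant q)
    ... | inj₁ e = e
    ... | inj₂ f = to-injective f

    fixed-by-unique-neighbour : ∀ {u v} → Fixed u → R u v → (∀ w → R u w → w ≡ v ⊎ Fixed w) →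
      Fixed v
    fixed-by-unique-neighbour fixed r neighbours =
      fixed-by-unique-candidate {Q = λ _ → ⊤} (λ _ → tt) fixed r tt (λ w r′ _ → neighbours w r′)

    isolated-from : ∀ {z} → Isolated R z → Isolated R (from z)
    isolated-from {z} isolated y r =
      isolated (to y) (subst (λ t → R t (to y)) (strictlyInverseˡ z) (forward r))

    at-most-one-invariant : Invariant (AtMostOneNeighbour R)
    at-most-one-invariant unique p q rp rq = begin
      p           ≡⟨ sym (strictlyInverseˡ p) ⟩
      to (from p) ≡⟨ cong to (unique _ _ (backward-from rp) (backward-from rq)) ⟩
      to (from q) ≡⟨ strictlyInverseˡ q ⟩
      q           ∎
      where open ≡-Reasoning

    two-invariant : Invariant (TwoNeighbours R)
    two-invariant (p , q , rp , rq , p≢q) =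
      to p , to q , forward rp , forward rq , λ e → p≢q (to-injective e)

    next-to-fixed-invariant : ∀ {P : V → Set} → Invariant (λ u → Σ V λ w → Fixed w × P w × R u w)
    next-to-fixed-invariant {v = u} (w , fixed , p , r) =
      w , fixed , p , subst (R (to u)) fixed (forward r)

  away-invariant : ∀ {S R} → Preserves S → Preserves R → Invariant (AwayFromIsolated S R)
  away-invariant preservesS preservesR away z isolated s =
    away (from z) (isolated-from preservesR isolated) (backward-from preservesS s)

LabelledEdge : ∀ {V} {G : Graph V} {d} → EdgeLabeling G d → Fin d → V → V → Set
LabelledEdge {G = G} ψ c u v = Σ (Adj G u v) λ e → EdgeLabeling.label ψ u v e ≡ c

PreservesLabels : ∀ {V} {G : Graph V} {d} → EdgeLabeling G d → Automorphism G → Set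
PreservesLabels {G = G} ψ σ =
  ∀ u v (e : Adj G u v) →
    label (to u) (to v) (proj₁ (preserve u v) e) ≡ label u v e
  where
  open EdgeLabeling ψ
  open Automorphism σ

module LabelPreserving {V} {G : Graph V} {d} (ψ : EdgeLabeling G d) (σ : Automorphism G)
                       (keeps : PreservesLabels ψ σ) where
  open Symmetry (Automorphism.perm σ) public
  open EdgeLabeling ψ

  adjacency-preserved : Preserves (Adj G)
  adjacency-preserved = record
    { forward  = λ {u} {v} → proj₁ (Automorphism.preserve σ u v)
    ; backward = λ {u} {v} → proj₂ (Automorphism.preserve σ u v) }

  labelled-edges-preserved : ∀ c → Preserves (LabelledEdge ψ c)
  labelled-edges-preserved c = record { forward = forward′ ; backward = backward′ }
    where
    open Preserves adjacency-preserved
    forward′ : ∀ {u v} → LabelledEdge ψ c u v → LabelledEdge ψ c (to u) (to v)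
    forward′ {u} {v} (e , labelled) = forward e , trans (keeps u v e) labelled
    backward′ : ∀ {u v} → LabelledEdge ψ c (to u) (to v) → LabelledEdge ψ c u v
    backward′ {u} {v} (e , labelled) = backward e , (begin
      label u v (backward e)                     ≡⟨ sym (keeps u v (backward e)) ⟩
      label (to u) (to v) (forward (backward e)) ≡⟨ cong (label (to u) (to v)) (Graph.prop G _ e) ⟩
      label (to u) (to v) e                      ≡⟨ labelled ⟩
      c                                          ∎)
      where open ≡-Reasoning

edge⇒no-labeling-with-0 : ∀ {V} {G : Graph V} {u v} → Adj G u v →
  ¬ HasDistinguishingLabeling G 0
edge⇒no-labeling-with-0 {u = u} {v} e (ψ , _) with EdgeLabeling.label ψ u v e
... | ()

nontrivial-automorphism⇒no-labeling-with-1 : ∀ {V} {G : Graph V} (σ : Automorphism G) {v} →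
  Automorphism.to σ v ≢ v → ¬ HasDistinguishingLabeling G 1
nontrivial-automorphism⇒no-labeling-with-1 σ {v} moves (ψ , distinguishing) =
  moves (distinguishing σ (λ _ _ _ → single-label _ _) v)
  where
  single-label : (a b : Fin 1) → a ≡ b
  single-label zero zero = refl

opposite-reverses-successor : ∀ {n} (i j : Fin n) → suc (toℕ i) ≡ toℕ j →
  suc (toℕ (opposite j)) ≡ toℕ (opposite i)
opposite-reverses-successor {n} i j i+1≡j = begin
  suc (toℕ (opposite j)) ≡⟨ cong suc (opposite-prop j) ⟩
  suc (n ∸ suc (toℕ j))   ≡⟨ sym (+-∸-assoc 1 (toℕ<n j)) ⟩
  n ∸ toℕ j               ≡⟨ cong (n ∸_) (sym i+1≡j) ⟩
  n ∸ suc (toℕ i)         ≡⟨ sym (opposite-prop i) ⟩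
  toℕ (opposite i)        ∎
  where open ≡-Reasoning

module Reflection (n : ℕ) {B : Set} (H : Graph B) where
  G : Graph (Fin n × B)
  G = Lex (PathGraph n) H

  reflect : Fin n × B → Fin n × B
  reflect (i , x) = opposite i , x

  reflect-involutive : ∀ v → reflect (reflect v) ≡ v
  reflect-involutive (i , x) = cong (_, x) (opposite-involutive i)

  reflect-adjacent : ∀ u v → Adj G u v → Adj G (reflect u) (reflect v)
  reflect-adjacent (i , _) (j , _) (inj₁ (inj₁ up))   = inj₁ (inj₂ (opposite-reverses-successor i j up))
  reflect-adjacent (i , _) (j , _) (inj₁ (inj₂ down)) = inj₁ (inj₁ (opposite-reverses-successor j i down))
  reflect-adjacent _ _ (inj₂ (same , e))             = inj₂ (cong opposite same , e)

  reflection : Automorphism G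
  reflection = record
    { perm     = mk↔ₛ′ reflect reflect reflect-involutive reflect-involutive
    ; preserve = λ u v → reflect-adjacent u v , λ e →
        subst₂ (Adj G) (reflect-involutive u) (reflect-involutive v)
               (reflect-adjacent (reflect u) (reflect v) e) }

two-labels-needed : ∀ n {B} (H : Graph B) → B → ∀ d → d < 2 →
  ¬ HasDistinguishingLabeling (Lex (PathGraph (suc (suc n))) H) d
two-labels-needed n H x zero _ = edge⇒no-labeling-with-0 {u = zero , x} {suc zero , x} (inj₁ (inj₁ refl))
two-labels-needed n H x (suc zero) _ =
  nontrivial-automorphism⇒no-labeling-with-1 (Reflection.reflection (suc (suc n)) H) moves
  where
  moves : (opposite zero , x) ≢ (zero , x)
  moves e with trans (sym (opposite-prop {suc (suc n)} zero)) (cong (λ v → toℕ (proj₁ v)) e)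
  ... | ()
two-labels-needed n H x (suc (suc _)) (s≤s (s≤s ()))

data RedStep : ℕ → ℕ → ℕ → ℕ → Set where
  rung     : ∀ x → RedStep 0 x 1 x
  diagonal : ∀ x → RedStep 0 x 1 (suc x)
  row      : ∀ i x → RedStep (suc i) (suc x) (suc (suc i)) (suc x)

RedCoords : ℕ → ℕ → ℕ → ℕ → Set
RedCoords i x j y = RedStep i x j y ⊎ RedStep j y i x

red-step? : ∀ i x j y → Dec (RedStep i x j y)
red-step? zero x zero y = no λ ()
red-step? zero x (suc zero) y with x ≟ y | suc x ≟ y
... | yes refl | _        = yes (rung x)
... | no _     | yes refl = yes (diagonal x)
... | no x≢y   | no x+1≢y = no λ { (rung _) → x≢y refl ; (diagonal _) → x+1≢y refl }
red-step? zero x (suc (suc j)) y = no λ ()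
red-step? (suc i) zero j y = no λ ()
red-step? (suc i) (suc x) j y with suc (suc i) ≟ j | suc x ≟ y
... | yes refl | yes refl = yes (row i x)
... | no i+2≢j | _        = no λ { (row _ _) → i+2≢j refl }
... | yes _    | no x≢y   = no λ { (row _ _) → x≢y refl }

red-coords? : ∀ i x j y → Dec (RedCoords i x j y)
red-coords? i x j y with red-step? i x j y | red-step? j y i x
... | yes s | _     = yes (inj₁ s)
... | no _  | yes s = yes (inj₂ s)
... | no s  | no t  = no [ s , t ]

red-step-layers : ∀ {i x j y} → RedStep i x j y → suc i ≡ j
red-step-layers (rung _)     = refl
red-step-layers (diagonal _) = refl
red-step-layers (row _ _)    = refl

red-from-layer0 : ∀ {i x j y} → i ≡ 0 → RedCoords i x j y → j ≡ 1 × (y ≡ x ⊎ y ≡ suc x)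
red-from-layer0 refl (inj₁ (rung _))     = refl , inj₁ refl
red-from-layer0 refl (inj₁ (diagonal _)) = refl , inj₂ refl

red-from-layer1 : ∀ {i x j y} → i ≡ 1 → RedCoords i x j y →
  (j ≡ 0 × (y ≡ x ⊎ suc y ≡ x)) ⊎ (j ≡ 2 × y ≡ x × 1 ≤ x)
red-from-layer1 refl (inj₁ (row _ _))     = inj₂ (refl , refl , s≤s z≤n)
red-from-layer1 refl (inj₂ (rung _))     = inj₁ (refl , inj₁ refl)
red-from-layer1 refl (inj₂ (diagonal _)) = inj₁ (refl , inj₂ refl)

red-from-high : ∀ {i′ i x j y} → i ≡ suc (suc i′) → RedCoords i x j y →
  y ≡ x × (j ≡ suc i′ ⊎ j ≡ suc (suc (suc i′)))
red-from-high refl (inj₁ (row _ _)) = refl , inj₂ refl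
red-from-high refl (inj₂ (row _ _)) = refl , inj₁ refl

red-upward : ∀ {i′ i x j y} → i ≡ suc i′ → RedCoords i x j y →
  j ≤ suc i′ ⊎ (j ≡ suc (suc i′) × y ≡ x)
red-upward refl (inj₁ (row _ _))     = inj₂ (refl , refl)
red-upward refl (inj₂ (rung _))     = inj₁ z≤n
red-upward refl (inj₂ (diagonal _)) = inj₁ z≤n
red-upward refl (inj₂ (row _ _))    = inj₁ (n≤1+n _)

high-red⇒positive-column : ∀ {i x j y} → 2 ≤ i → RedCoords i x j y → 1 ≤ x
high-red⇒positive-column _ (inj₁ (row _ _)) = s≤s z≤n
high-red⇒positive-column _ (inj₂ (row _ _)) = s≤s z≤n
high-red⇒positive-column (s≤s ()) (inj₂ (rung _))
high-red⇒positive-column (s≤s ()) (inj₂ (diagonal _))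

row-up : ∀ {i x} → 1 ≤ x → RedCoords (suc i) x (suc (suc i)) x
row-up {i} {suc x} _ = inj₁ (row i x)

indicator : {P : Set} → Dec P → Fin 2
indicator (yes _) = suc zero
indicator (no _)  = zero

indicator-cong : {P Q : Set} → (P → Q) → (Q → P) → (p : Dec P) (q : Dec Q) →
  indicator p ≡ indicator q
indicator-cong _ _ (yes _) (yes _) = refl
indicator-cong _ _ (no _)  (no _)  = refl
indicator-cong f _ (yes p) (no ¬q) = ⊥-elim (¬q (f p))
indicator-cong _ g (no ¬p) (yes q) = ⊥-elim (¬p (g q))

indicator-yes : {P : Set} (p : Dec P) → P → indicator p ≡ suc zero
indicator-yes (yes _) _  = refl
indicator-yes (no ¬p) p = ⊥-elim (¬p p)

indicator-one : {P : Set} (p : Dec P) → indicator p ≡ suc zero → P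
indicator-one (yes p) _ = p

module RedLabeling (n : ℕ) {m} (H : Graph (Fin m)) where
  V : Set
  V = Fin n × Fin m

  G : Graph V
  G = Lex (PathGraph n) H

  layer column : V → ℕ
  layer  v = toℕ (proj₁ v)
  column v = toℕ (proj₂ v)

  coords-injective : ∀ {u v} → layer u ≡ layer v → column u ≡ column v → u ≡ v
  coords-injective same-layer same-column =
    cong₂ _,_ (toℕ-injective same-layer) (toℕ-injective same-column)

  RedVertices : V → V → Set
  RedVertices u v = RedCoords (layer u) (column u) (layer v) (column v)

  red-vertices? : ∀ u v → Dec (RedVertices u v)
  red-vertices? u v = red-coords? _ _ _ _

  red-labeling : EdgeLabeling G 2
  red-labeling = record
    { label     = λ u v _ → indicator (red-vertices? u v)
    ; label-sym = λ u v _ → indicator-cong swap swap (red-vertices? v u) (red-vertices? u v) }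

  Red : V → V → Set
  Red = LabelledEdge red-labeling (suc zero)

  red⇒coords : ∀ {u v} → Red u v → RedVertices u v
  red⇒coords {u} {v} (_ , red) = indicator-one (red-vertices? u v) red

  red-at : ∀ {u v i x j y} → layer u ≡ i → column u ≡ x → layer v ≡ j → column v ≡ y →
    RedCoords i x j y → Red u v
  red-at {u} {v} refl refl refl refl r = adjacent r , indicator-yes (red-vertices? u v) r
    where
    adjacent : RedVertices u v → Adj G u v
    adjacent (inj₁ s) = inj₁ (inj₁ (red-step-layers s))
    adjacent (inj₂ s) = inj₁ (inj₂ (red-step-layers s))

zero-or-positive : ∀ a → a ≡ 0 ⊎ 1 ≤ a
zero-or-positive zero    = inj₁ refl
zero-or-positive (suc _) = inj₂ (s≤s z≤n)

connected⇒has-neighbour : ∀ {V} {G : Graph V} → Connected G → ∀ {a b} → a ≢ b → Σ V (Adj G a)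
connected⇒has-neighbour connected {a} {b} a≢b with connected a b
... | here     = ⊥-elim (a≢b refl)
... | step e _ = _ , e

3≮3+k⇒k≡0 : ∀ k → ¬ 3 < suc (suc (suc k)) → k ≡ 0
3≮3+k⇒k≡0 zero    _   = refl
3≮3+k⇒k≡0 (suc _) 3≮n = ⊥-elim (3≮n (s≤s (s≤s (s≤s (s≤s z≤n)))))

module Rigidity (k m′ : ℕ) (H : Graph (Fin (suc m′))) (connected : Connected H) where
  n m : ℕ
  n = suc (suc (suc k))
  m = suc m′

  open RedLabeling n H

  last-vertex-has-smaller-neighbour : (c : Fin m) → c ≢ zero → ¬ suc (toℕ c) < m →
    Σ (Fin m) λ y → toℕ y < toℕ c × Adj H c y
  last-vertex-has-smaller-neighbour c c≢0 c-last with connected⇒has-neighbour connected c≢0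
  ... | y , e = y , ≤∧≢⇒< (≤-pred (≤-trans (toℕ<n y) (≮⇒≥ c-last))) y≢c , e
    where
    y≢c : toℕ y ≢ toℕ c
    y≢c same = Graph.irrefl H (subst (Adj H c) (toℕ-injective same) e)

  Away : V → Set
  Away = AwayFromIsolated (Adj G) Red

  column0-isolated : ∀ z → 2 ≤ layer z → column z ≡ 0 → Isolated Red z
  column0-isolated z high c0 _ r with subst (1 ≤_) c0 (high-red⇒positive-column high (red⇒coords r))
  ... | ()

  layer0-away : ∀ u → layer u ≡ 0 → Away u
  layer0-away u l0 z isolated (inj₁ (inj₁ up)) =
    isolated (zero , proj₂ z) (red-at (trans (sym up) (cong suc l0)) refl refl refl (inj₂ (rung _)))
  layer0-away u l0 z isolated (inj₁ (inj₂ down)) with trans down l0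
  ... | ()
  layer0-away u l0 z isolated (inj₂ (same , _)) =
    isolated (suc zero , proj₂ z) (red-at (trans (cong toℕ (sym same)) l0) refl refl refl (inj₁ (rung _)))

  next-to-high-layer⇒¬away : ∀ u {t} → t < n → 2 ≤ t → suc (layer u) ≡ t ⊎ suc t ≡ layer u →
    ¬ Away u
  next-to-high-layer⇒¬away u {t} t<n 2≤t path away =
    away z (column0-isolated z (subst (2 ≤_) (sym layer-z) 2≤t) refl) (inj₁ path′)
    where
    z : V
    z = fromℕ< t<n , zero
    layer-z : layer z ≡ t
    layer-z = toℕ-fromℕ< t<n
    path′ : PathAdj (proj₁ u) (proj₁ z)
    path′ = Sum.map (λ up → trans up (sym layer-z)) (trans (cong suc layer-z)) path

  away⇒bottom-or-short-top : ∀ u → Away u → layer u ≡ 0 ⊎ (layer u ≡ 2 × k ≡ 0)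
  away⇒bottom-or-short-top u = by-layer (layer u) refl
    where
    by-layer : ∀ i → layer u ≡ i → Away u → i ≡ 0 ⊎ (i ≡ 2 × k ≡ 0)
    by-layer zero _ _ = inj₁ refl
    by-layer (suc zero) l1 away =
      ⊥-elim (next-to-high-layer⇒¬away u (s≤s (s≤s (s≤s z≤n))) ≤-refl (inj₁ (cong suc l1)) away)
    by-layer (suc (suc zero)) l2 away with 3 <? n
    ... | yes 3<n = ⊥-elim (next-to-high-layer⇒¬away u 3<n (s≤s (s≤s z≤n)) (inj₁ (cong suc l2)) away)
    ... | no 3≮n  = inj₂ (refl , 3≮3+k⇒k≡0 k 3≮n)
    by-layer (suc (suc (suc i))) l away =
      ⊥-elim (next-to-high-layer⇒¬away u t<n (s≤s (s≤s z≤n)) (inj₂ (sym l)) away)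
      where
      t<n : suc (suc i) < n
      t<n = <-trans (n<1+n _) (subst (_< n) l (toℕ<n (proj₁ u)))

  short-top-red-neighbour : k ≡ 0 → ∀ {u w} → layer u ≡ 2 → Red u w →
    layer w ≡ 1 × column w ≡ column u
  short-top-red-neighbour refl {u} {w} l2 r with red-from-high l2 (red⇒coords r)
  ... | same , inj₁ l1 = l1 , same
  ... | _    , inj₂ l3 with subst (_< n) l3 (toℕ<n (proj₁ w))
  ...   | s≤s (s≤s (s≤s ()))

  layer1-branching : ∀ w → layer w ≡ 1 → 1 ≤ column w → ¬ AtMostOneNeighbour Red w
  layer1-branching w l1 positive unique
    with cong layer (unique (zero , proj₂ w) (suc (suc zero) , proj₂ w)
                            (red-at l1 refl refl refl (inj₂ (rung _)))
                            (red-at l1 refl refl refl (row-up positive)))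
  ... | ()

  Anchor : V → Set
  Anchor u = Away u × Σ V λ w → Red u w × AtMostOneNeighbour Red w

  origin origin-rung : V
  origin      = zero , zero
  origin-rung = suc zero , zero

  origin-rung-leaf : AtMostOneNeighbour Red origin-rung
  origin-rung-leaf p q rp rq = trans (only p rp) (sym (only q rq))
    where
    only : ∀ p → Red origin-rung p → p ≡ origin
    only p r with red-from-layer1 refl (red⇒coords r)
    ... | inj₁ (l0 , inj₁ c0) = coords-injective l0 c0
    ... | inj₁ (_ , inj₂ ())
    ... | inj₂ (_ , _ , ())

  anchor-origin : Anchor origin
  anchor-origin =
    layer0-away origin refl , origin-rung , red-at refl refl refl refl (inj₁ (rung 0)) , origin-rung-leaf

  anchor⇒origin : ∀ u → Anchor u → u ≡ origin
  anchor⇒origin u (away , w , r , w-leaf) with away⇒bottom-or-short-top u away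
  ... | inj₂ (l2 , k0) with short-top-red-neighbour k0 l2 r
  ...   | l1 , same = ⊥-elim (layer1-branching w l1 positive w-leaf)
    where
    positive : 1 ≤ column w
    positive = subst (1 ≤_) (sym same)
      (high-red⇒positive-column (≤-reflexive (sym l2)) (red⇒coords r))
  anchor⇒origin u (away , w , r , w-leaf) | inj₁ l0
    with red-from-layer0 l0 (red⇒coords r) | zero-or-positive (column w)
  ... | l1 , _          | inj₂ positive = ⊥-elim (layer1-branching w l1 positive w-leaf)
  ... | _  , inj₁ same  | inj₁ c0      = coords-injective l0 (trans (sym same) c0)
  ... | _  , inj₂ above | inj₁ c0      with trans (sym above) c0
  ...   | ()

  module FixedPoints (σ : Automorphism G) (keeps : PreservesLabels red-labeling σ) where
    open LabelPreserving red-labeling σ keeps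

    red-preserved : Preserves Red
    red-preserved = labelled-edges-preserved (suc zero)

    origin-fixed : Fixed origin
    origin-fixed = anchor⇒origin (to origin) (invariant anchor-origin)
      where
      invariant : Invariant Anchor
      invariant (away , w , r , w-leaf) =
        away-invariant adjacency-preserved red-preserved away ,
        to w , Preserves.forward red-preserved r , at-most-one-invariant red-preserved w-leaf

    -- Separates (0,x) from (2,x) when n = 3, where layers 0 and 2 look alike.
    BottomLike : V → Set
    BottomLike u = Away u × (TwoNeighbours Red u ⊎ Σ V λ w → Fixed w × layer w ≡ 0 × Adj G u w)

    bottom-like-invariant : Invariant BottomLike
    bottom-like-invariant (away , rest) =
      away-invariant adjacency-preserved red-preserved away ,
      Sum.map (two-invariant red-preserved) (next-to-fixed-invariant adjacency-preserved) rest

    layer2-not-bottom-like : ∀ u → layer u ≡ 2 → ¬ BottomLike u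
    layer2-not-bottom-like u l2 (away , rest) with away⇒bottom-or-short-top u away
    ... | inj₁ l0 with trans (sym l2) l0
    ...   | ()
    layer2-not-bottom-like u l2 (away , inj₁ (p , q , rp , rq , p≢q)) | inj₂ (_ , k0)
      with short-top-red-neighbour k0 l2 rp | short-top-red-neighbour k0 l2 rq
    ... | lp , cp | lq , cq = p≢q (coords-injective (trans lp (sym lq)) (trans cp (sym cq)))
    layer2-not-bottom-like u l2 (away , inj₂ (w , _ , l0 , adjacent)) | inj₂ _ =
      apart adjacent
      where
      apart : ¬ Adj G u w
      apart (inj₁ (inj₁ up)) with trans (sym (cong suc l2)) (trans up l0)
      ... | ()
      apart (inj₁ (inj₂ down)) with trans (sym (cong suc l0)) (trans down l2)
      ... | ()
      apart (inj₂ (same , _)) with trans (sym l2) (trans (cong toℕ same) l0)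
      ... | ()

    bottom-like-after : ∀ x (c : Fin m) → toℕ c ≡ suc x → (∀ v → layer v ≡ 0 → column v ≤ x → Fixed v) →
      BottomLike (zero , c)
    bottom-like-after x c column-c bottom = layer0-away (zero , c) refl , two-or-next-to-fixed
      where
      two-or-next-to-fixed : TwoNeighbours Red (zero , c) ⊎ Σ V λ w → Fixed w × layer w ≡ 0 × Adj G (zero , c) w
      two-or-next-to-fixed with suc (suc x) <? m
      ... | yes x+2<m = inj₁ (p , q , red-at refl column-c refl column-c (inj₁ (rung _)) ,
                              red-at refl column-c refl (toℕ-fromℕ< x+2<m) (inj₁ (diagonal _)) , p≢q)
        where
        p q : V
        p = suc zero , c
        q = suc zero , fromℕ< x+2<m
        p≢q : p ≢ q
        p≢q same = 1+n≢n (sym (trans (sym column-c) (trans (cong column same) (toℕ-fromℕ< x+2<m))))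
      ... | no x+2≮m with last-vertex-has-smaller-neighbour c c≢0
                            (λ last → x+2≮m (subst (λ t → suc t < m) column-c last))
        where
        c≢0 : c ≢ zero
        c≢0 same with trans (sym column-c) (cong toℕ same)
        ... | ()
      ...   | y , y<x+1 , e =
        inj₂ ((zero , y) , bottom (zero , y) refl (≤-pred (subst (toℕ y <_) column-c y<x+1)) , refl , inj₂ (refl , e))

    Zigzag : ℕ → Set
    Zigzag x = (∀ v → layer v ≡ 0 → column v ≤ x → Fixed v) × (∀ v → layer v ≡ 1 → column v ≡ x → Fixed v)

    zigzag-start : Zigzag 0
    zigzag-start = bottom , top
      where
      bottom : ∀ v → layer v ≡ 0 → column v ≤ 0 → Fixed v
      bottom v l0 c≤0 = subst Fixed (sym (coords-injective l0 (n≤0⇒n≡0 c≤0))) origin-fixed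
      origin-rung-fixed : Fixed origin-rung
      origin-rung-fixed =
        fixed-by-unique-candidate red-preserved (at-most-one-invariant red-preserved) origin-fixed
          (red-at refl refl refl refl (inj₁ (rung 0))) origin-rung-leaf candidates
        where
        candidates : ∀ w → Red origin w → AtMostOneNeighbour Red w → w ≡ origin-rung ⊎ Fixed w
        candidates w r w-leaf with red-from-layer0 refl (red⇒coords r)
        ... | l1 , inj₁ c0 = inj₁ (coords-injective l1 c0)
        ... | l1 , inj₂ c1 = ⊥-elim (layer1-branching w l1 (≤-reflexive (sym c1)) w-leaf)
      top : ∀ v → layer v ≡ 1 → column v ≡ 0 → Fixed v
      top v l1 c0 = subst Fixed (sym (coords-injective l1 c0)) origin-rung-fixed

    zigzag-step : ∀ x → suc x < m → Zigzag x → Zigzag (suc x)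
    zigzag-step x x+1<m (bottom , top) = bottom′ , top′
      where
      x<m : x < m
      x<m = <-trans (n<1+n x) x+1<m
      a b a′ : V
      a  = zero , fromℕ< x<m
      b  = suc zero , fromℕ< x+1<m
      a′ = zero , fromℕ< x+1<m
      column-a : column a ≡ x
      column-a = toℕ-fromℕ< x<m
      column-b : column b ≡ suc x
      column-b = toℕ-fromℕ< x+1<m

      b-fixed : Fixed b
      b-fixed =
        fixed-by-unique-neighbour red-preserved (bottom a refl (≤-reflexive column-a))
          (red-at refl column-a refl column-b (inj₁ (diagonal x))) candidates
        where
        candidates : ∀ w → Red a w → w ≡ b ⊎ Fixed w
        candidates w r with red-from-layer0 refl (red⇒coords r)
        ... | l1 , inj₁ same  = inj₂ (top w l1 (trans same column-a))
        ... | l1 , inj₂ above = inj₁ (coords-injective l1 (trans above (trans (cong suc column-a) (sym column-b))))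

      a′-fixed : Fixed a′
      a′-fixed =
        fixed-by-unique-candidate red-preserved bottom-like-invariant b-fixed
          (red-at refl column-b refl column-b (inj₂ (rung _)))
          (bottom-like-after x (proj₂ a′) column-b bottom) candidates
        where
        candidates : ∀ w → Red b w → BottomLike w → w ≡ a′ ⊎ Fixed w
        candidates w r w-bottom-like with red-from-layer1 refl (red⇒coords r)
        ... | inj₁ (l0 , inj₁ same)  = inj₁ (coords-injective l0 same)
        ... | inj₁ (l0 , inj₂ below) = inj₂ (bottom w l0 (≤-reflexive (suc-injective (trans below column-b))))
        ... | inj₂ (l2 , _)          = ⊥-elim (layer2-not-bottom-like w l2 w-bottom-like)

      bottom′ : ∀ v → layer v ≡ 0 → column v ≤ suc x → Fixed v
      bottom′ v l0 c≤x+1 with m≤n⇒m<n∨m≡n c≤x+1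
      ... | inj₁ c<x+1 = bottom v l0 (≤-pred c<x+1)
      ... | inj₂ c≡x+1 = subst Fixed (sym (coords-injective l0 (trans c≡x+1 (sym column-b)))) a′-fixed

      top′ : ∀ v → layer v ≡ 1 → column v ≡ suc x → Fixed v
      top′ v l1 c≡x+1 = subst Fixed (sym (coords-injective l1 (trans c≡x+1 (sym column-b)))) b-fixed

    zigzag : ∀ x → x < m → Zigzag x
    zigzag zero    _     = zigzag-start
    zigzag (suc x) x+1<m = zigzag-step x x+1<m (zigzag x (<-trans (n<1+n x) x+1<m))

    fixed-bottom-layers : ∀ v → layer v ≤ 1 → Fixed v
    fixed-bottom-layers v l≤1 with m≤n⇒m<n∨m≡n l≤1 | zigzag (column v) (toℕ<n (proj₂ v))
    ... | inj₁ l<1 | bottom , _ = bottom v (n≤0⇒n≡0 (≤-pred l<1)) ≤-refl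
    ... | inj₂ l≡1 | _ , top    = top v l≡1 refl

    fixed-next-layer : ∀ i → (∀ v → layer v ≤ suc i → Fixed v) → ∀ v → layer v ≡ suc (suc i) → Fixed v
    fixed-next-layer i below = fixed-layer
      where
      below-top : ∀ w → layer w ≡ suc (suc i) → suc i < n
      below-top w lw = <-trans (n<1+n _) (subst (_< n) lw (toℕ<n (proj₁ w)))

      down : ∀ w → layer w ≡ suc (suc i) → V
      down w lw = fromℕ< (below-top w lw) , proj₂ w

      layer-down : ∀ w lw → layer (down w lw) ≡ suc i
      layer-down w lw = toℕ-fromℕ< (below-top w lw)

      down-fixed : ∀ w lw → Fixed (down w lw)
      down-fixed w lw = below (down w lw) (≤-reflexive (layer-down w lw))

      fixed-positive : ∀ w → layer w ≡ suc (suc i) → 1 ≤ column w → Fixed w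
      fixed-positive w lw positive =
        fixed-by-unique-neighbour red-preserved (down-fixed w lw)
          (red-at (layer-down w lw) refl lw refl (row-up positive)) candidates
        where
        candidates : ∀ w′ → Red (down w lw) w′ → w′ ≡ w ⊎ Fixed w′
        candidates w′ r with red-upward (layer-down w lw) (red⇒coords r)
        ... | inj₁ lower       = inj₂ (below w′ lower)
        ... | inj₂ (l′ , same) = inj₁ (coords-injective (trans l′ (sym lw)) same)

      fixed-layer : ∀ w → layer w ≡ suc (suc i) → Fixed w
      fixed-layer w lw with zero-or-positive (column w)
      ... | inj₂ positive = fixed-positive w lw positive
      ... | inj₁ c0 =
        fixed-by-unique-neighbour adjacency-preserved (down-fixed w lw)
          (inj₁ (inj₁ (trans (cong suc (layer-down w lw)) (sym lw)))) candidates
        where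
        same-layer : ∀ w′ → layer w′ ≡ suc (suc i) → w′ ≡ w ⊎ Fixed w′
        same-layer w′ l′ with zero-or-positive (column w′)
        ... | inj₁ c0′      = inj₁ (coords-injective (trans l′ (sym lw)) (trans c0′ (sym c0)))
        ... | inj₂ positive = inj₂ (fixed-positive w′ l′ positive)
        candidates : ∀ w′ → Adj G (down w lw) w′ → w′ ≡ w ⊎ Fixed w′
        candidates w′ (inj₁ (inj₁ up))   = same-layer w′ (trans (sym up) (cong suc (layer-down w lw)))
        candidates w′ (inj₁ (inj₂ down)) =
          inj₂ (below w′ (≤-trans (n≤1+n _) (≤-reflexive (trans down (layer-down w lw)))))
        candidates w′ (inj₂ (same , _))  =
          inj₂ (below w′ (≤-reflexive (trans (cong toℕ (sym same)) (layer-down w lw))))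

    fixed-up-to : ∀ i v → layer v ≤ suc i → Fixed v
    fixed-up-to zero = fixed-bottom-layers
    fixed-up-to (suc i) v l≤i+2 with m≤n⇒m<n∨m≡n l≤i+2
    ... | inj₁ l<i+2 = fixed-up-to i v (≤-pred l<i+2)
    ... | inj₂ l≡i+2 = fixed-next-layer i (fixed-up-to i) v l≡i+2

    all-fixed : ∀ v → Fixed v
    all-fixed v = fixed-up-to (suc k) v (≤-pred (toℕ<n (proj₁ v)))

  distinguishing : Distinguishing red-labeling
  distinguishing σ keeps = FixedPoints.all-fixed σ keeps

proposition3p4 : (n m : ℕ) → n ≥ 3 → m ≥ 1 → (H : Graph (Fin m)) → Connected H →
    DistinguishingIndex≡ (Lex (PathGraph n) H) 2
proposition3p4 (suc (suc (suc k))) (suc m′) _ _ H connected =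
  (RedLabeling.red-labeling (suc (suc (suc k))) H , Rigidity.distinguishing k m′ H connected) ,
  two-labels-needed (suc k) H zero
proposition3p4 (suc (suc (suc _))) zero _ () _ _
proposition3p4 (suc (suc zero)) _ (s≤s (s≤s ())) _ _ _
proposition3p4 (suc zero) _ (s≤s ()) _ _ _
proposition3p4 zero _ () _ _ _
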